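{- Let $k\in\mathbb{N}$ and let $G$ be a minor-obstruction of $\mathcal{V}_k$. Then every connected component of $G$ is 2-connected. Consequently, the bridges of $G$ are isolated edges (i.e., connected components isomorphic to $K_2$).
   Context: $\mathcal{V}_k$ is the class of graphs with a vertex cover of size at most $k$. A minor-obstruction of a class $\mathcal{C}$ is a graph not in $\mathcal{C}$ all of whose proper minors are in $\mathcal{C}$. A graph $H$ is 2-connected if $H-X$ is connected for every set $X$ of at most one vertex. A bridge is an edge whose removal increases the number of connected components. -}

module Defs where

open import Data.Nat using (ℕ; _≤_; _<_)
open import Data.Fin using (Fin)
open import Data.Fin.Subset using (Subset; _∈_; ∣_∣)
open import Data.Bool using (Bool; true; false; _∧_; not)
open import Data.Maybe using (Maybe; just)
open import Data.Product using (Σ; ∃; ∃₂; _×_)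
open import Data.Sum using (_⊎_)
open import Relation.Nullary using (¬_)
open import Relation.Binary.PropositionalEquality using (_≡_; _≢_)
open import Function.Bundles using (_↔_; Inverse)

record Graph : Set where
  field
    n     : ℕ
    E     : Fin n → Fin n → Bool
    E-sym : ∀ u v → E u v ≡ E v u
    E-irr : ∀ v → E v v ≡ false
open Graph public

data ReachIn {n : ℕ} (Adj : Fin n → Fin n → Bool) (P : Fin n → Set)
       : Fin n → Fin n → Set where
  here : ∀ {v} → P v → ReachIn Adj P v v
  step : ∀ {u w v} → P u → Adj u w ≡ true → ReachIn Adj P w v → ReachIn Adj P u v

Reach : {n : ℕ} (Adj : Fin n → Fin n → Bool) → Fin n → Fin n → Set
Reach Adj = ReachIn Adj (λ _ → Data.Unit.⊤)
  where import Data.Unit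

-- The vertex set P induces a connected subgraph (empty set counts as connected).
ConnectedIn : {n : ℕ} (Adj : Fin n → Fin n → Bool) (P : Fin n → Set) → Set
ConnectedIn Adj P = ∀ u v → P u → P v → ReachIn Adj P u v

IsComponent : (G : Graph) → Subset (n G) → Set
IsComponent G C =
  (∃ λ v → v ∈ C) ×
  ConnectedIn (E G) (λ v → v ∈ C) ×
  (∀ u w → u ∈ C → E G u w ≡ true → w ∈ C)

TwoConnectedIn : (G : Graph) → Subset (n G) → Set
TwoConnectedIn G C =
  ConnectedIn (E G) (λ v → v ∈ C) ×
  (∀ x → ConnectedIn (E G) (λ v → v ∈ C × v ≢ x))

HasNumComponents : {n : ℕ} (Adj : Fin n → Fin n → Bool) → ℕ → Set
HasNumComponents {n} Adj c =
  Σ (Fin c → Fin n) λ r →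
    (∀ i j → Reach Adj (r i) (r j) → i ≡ j) ×
    (∀ v → ∃ λ i → Reach Adj (r i) v)

deleteEdge : (G : Graph) → Fin (n G) → Fin (n G) → Fin (n G) → Fin (n G) → Bool
deleteEdge G u v a b = E G a b ∧ not (isUV a b)
  where
    open import Data.Fin using (_≟_)
    open import Relation.Nullary.Decidable using (⌊_⌋)
    open import Data.Bool using (_∨_)
    isUV : Fin (n G) → Fin (n G) → Bool
    isUV a b = (⌊ a ≟ u ⌋ ∧ ⌊ b ≟ v ⌋) ∨ (⌊ a ≟ v ⌋ ∧ ⌊ b ≟ u ⌋)

IsBridge : (G : Graph) → Fin (n G) → Fin (n G) → Set
IsBridge G u v =
  E G u v ≡ true ×
  (∀ c c' → HasNumComponents (E G) c → HasNumComponents (deleteEdge G u v) c' → c < c')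

HasVCAtMost : ℕ → Graph → Set
HasVCAtMost k G =
  Σ (Subset (n G)) λ S → ∣ S ∣ ≤ k × (∀ u v → E G u v ≡ true → u ∈ S ⊎ v ∈ S)

Iso : Graph → Graph → Set
Iso G H = Σ (Fin (n G) ↔ Fin (n H)) λ f →
  ∀ u v → E H (Inverse.to f u) (Inverse.to f v) ≡ E G u v

-- H is a minor of G, via a minor model: β maps each vertex of G to the
-- branch set it belongs to (or nothing); branch sets are nonempty and
-- connected in G, and each edge of H is realised by an edge of G between
-- the corresponding branch sets.
record MinorModel (H G : Graph) : Set where
  field
    β         : Fin (n G) → Maybe (Fin (n H))
    nonempty  : ∀ h → ∃ λ g → β g ≡ just h
    connected : ∀ h → ConnectedIn (E G) (λ g → β g ≡ just h)
    edges     : ∀ h h' → E H h h' ≡ true →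
                ∃₂ λ g g' → β g ≡ just h × β g' ≡ just h' × E G g g' ≡ true

IsMinor : Graph → Graph → Set
IsMinor H G = MinorModel H G

IsProperMinor : Graph → Graph → Set
IsProperMinor H G = IsMinor H G × ¬ Iso G H

IsObstruction : ℕ → Graph → Set
IsObstruction k G = (¬ HasVCAtMost k G) × (∀ H → IsProperMinor H G → HasVCAtMost k H)

{-# OPTIONS --safe #-}
module Submission where

-- Suppose a vertex x separates two vertices u, v of a component, and let L be
-- the set of vertices reachable from u without passing through x. As x has
-- neighbours both in L and outside L, deleting the edges from x to ∁ L, or
-- those from x to L, gives a proper minor, with a vertex cover S₁, resp. S₂,
-- of size at most k. If one of them contains x it already covers G. Otherwise
-- both S₁ on L with S₂ off L, and S₂ on L with S₁ off L together with x, cover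
-- G; their sizes add up to ∣S₁∣ + ∣S₂∣ + 1 ≤ 2k + 1, so one of them has size at
-- most k, contradicting G ∉ 𝒱ₖ.
--
-- If uv is a bridge and w is a third vertex in the component of u, then by
-- 2-connectivity w reaches v avoiding u and reaches u avoiding v. Neither walk
-- uses uv, so u and v stay connected in G − uv, and deleting uv does not
-- increase the number of components.

open import Defs
open import Data.Bool using (Bool; true; false; _∧_; _∨_; not; if_then_else_) renaming (_≟_ to _≟ᵇ_)
open import Data.Bool.Properties using (∨-comm; ∧-comm; ∧-zeroʳ)
open import Data.Empty using (⊥-elim)
open import Data.Fin using (Fin; zero; suc; _≟_) renaming (_<_ to _<ᶠ_)
open import Data.Fin.Induction using () renaming (<-wellFounded to <ᶠ-wellFounded)
open import Data.Fin.Properties using (any?; _<?_; <-cmp)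
open import Data.Fin.Subset using (Subset; _∈_; _∉_; ∣_∣; ⁅_⁆; _∪_; ∁; inside; outside)
open import Data.Fin.Subset.Properties
  using (_∈?_; p⊂q⇒∣p∣<∣q∣; ∣⁅x⁆∣≡1; ∣p∣≤∣x∷p∣; x∈⁅x⁆; x∈p∪q⁺; x∈p⇒x∉∁p; x∉p⇒x∈∁p)
open import Data.List using (List; length; filter; allFin)
import Data.List as List
import Data.List.Relation.Unary.All as All
import Data.List.Relation.Unary.Any as Any
open import Data.List.Relation.Unary.AllPairs using (_∷_)
open import Data.List.Relation.Unary.Any.Properties using (lookup-index)
open import Data.List.Relation.Unary.Unique.Propositional using (Unique)
open import Data.List.Relation.Unary.Unique.Propositional.Properties using (allFin⁺; filter⁺)
open import Data.List.Membership.Propositional.Properties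
  using (∈-lookup; ∈-filter⁺; ∈-filter⁻; ∈-allFin)
open import Data.Maybe using (just)
open import Data.Nat using (ℕ; zero; suc; _+_; _≤_; _<_; z≤n; s≤s; _≤?_)
open import Data.Nat.Induction using (<-wellFounded)
open import Data.Nat.Properties
  using (≤-refl; ≤-trans; <-irrefl; +-suc; +-comm; +-mono-≤; +-mono-<-≤; +-mono-≤-<;
         +-monoʳ-≤; +-monoˡ-≤; +-cancelˡ-≤; ≰⇒>; +-0-commutativeMonoid; module ≤-Reasoning)
open import Algebra.Properties.CommutativeMonoid.Sum +-0-commutativeMonoid
  using (sum; sum-cong-≗; sum-permute)
open import Data.Product using (∃; _×_; _,_; proj₁; proj₂; map₂)
open import Data.Sum using (_⊎_; inj₁; inj₂; [_,_]′; swap; fromInj₂) renaming (map to ⊎-map)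
open import Data.Unit using (tt)
open import Data.Vec using (_∷_; []; tabulate; here; there)
open import Data.Vec.Properties using (lookup∘tabulate; []=⇒lookup; lookup⇒[]=)
open import Function using (_∘_; _↔_; Inverse)
open import Induction.WellFounded using (Acc; acc)
open import Level using (0ℓ)
open import Relation.Binary using (tri<; tri≈; tri>)
open import Relation.Binary.PropositionalEquality
  using (_≡_; _≢_; refl; sym; trans; cong; cong₂; subst; module ≡-Reasoning)
open import Relation.Nullary using (Dec; yes; no; does; ¬_; ¬?)
open import Relation.Nullary.Decidable
  using (⌊_⌋; _×-dec_; dec-true; dec-false; decidable-stable) renaming (map′ to Dec-map′)
open import Relation.Unary using (Pred; Decidable)

Undirected : ∀ {m} → (Fin m → Fin m → Bool) → Set
Undirected Adj = ∀ a b → Adj a b ≡ Adj b a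

_∖_ : ∀ {m} → (Fin m → Set) → Fin m → Fin m → Set
(P ∖ x) w = P w × w ≢ x

_∖?_ : ∀ {m} {P : Fin m → Set} → Decidable P → ∀ x → Decidable (P ∖ x)
(P? ∖? x) w = P? w ×-dec ¬? (w ≟ x)

module _ {m : ℕ} {Adj : Fin m → Fin m → Bool} where

  source-P : ∀ {P u v} → ReachIn Adj P u v → P u
  source-P (here p)     = p
  source-P (step p _ _) = p

  target-P : ∀ {P u v} → ReachIn Adj P u v → P v
  target-P (here p)     = p
  target-P (step _ _ r) = target-P r

  infixr 5 _++_
  _++_ : ∀ {P u w v} → ReachIn Adj P u w → ReachIn Adj P w v → ReachIn Adj P u v
  here _       ++ r′ = r′
  step p e r   ++ r′ = step p e (r ++ r′)

  snoc : ∀ {P u w v} → ReachIn Adj P u w → Adj w v ≡ true → P v → ReachIn Adj P u v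
  snoc r e pv = r ++ step (target-P r) e (here pv)

  reverse : Undirected Adj → ∀ {P u v} → ReachIn Adj P u v → ReachIn Adj P v u
  reverse undirected (here p)     = here p
  reverse undirected (step p e r) = snoc (reverse undirected r) (trans (undirected _ _) e) p

  lastVisit : ∀ {P a v} u → u ≢ v → ReachIn Adj P a v →
              ReachIn Adj (P ∖ u) a v ⊎ ∃ λ w → Adj u w ≡ true × ReachIn Adj (P ∖ u) w v
  lastVisit u u≢v (here p) = inj₁ (here (p , u≢v ∘ sym))
  lastVisit {a = a} u u≢v (step {w = w} p e r) with lastVisit u u≢v r | a ≟ u
  ... | inj₂ departure | _        = inj₂ departure
  ... | inj₁ r′        | yes refl = inj₂ (w , e , r′)
  ... | inj₁ r′        | no a≢u   = inj₁ (step (p , a≢u) e r′)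

  lastDeparture : ∀ {P u v} → u ≢ v → ReachIn Adj P u v →
                  ∃ λ w → Adj u w ≡ true × ReachIn Adj (P ∖ u) w v
  lastDeparture {u = u} u≢v r with lastVisit u u≢v r
  ... | inj₁ r′        = ⊥-elim (proj₂ (source-P r′) refl)
  ... | inj₂ departure = departure

ReachIn-map : ∀ {m} {A B : Fin m → Fin m → Bool} {P Q : Fin m → Set} {u v} →
  (∀ {w} → P w → Q w) → (∀ {a b} → P a → P b → A a b ≡ true → B a b ≡ true) →
  ReachIn A P u v → ReachIn B Q u v
ReachIn-map f g (here p)     = here (f p)
ReachIn-map f g (step p e r) = step (f p) (g p (source-P r) e) (ReachIn-map f g r)

weaken : ∀ {m} {A : Fin m → Fin m → Bool} {P Q : Fin m → Set} {u v} →
  (∀ {w} → P w → Q w) → ReachIn A P u v → ReachIn A Q u v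
weaken f = ReachIn-map f λ _ _ e → e

subset : ∀ {m} {P : Pred (Fin m) 0ℓ} → Decidable P → Subset m
subset P? = tabulate (does ∘ P?)

module _ {m} {P : Pred (Fin m) 0ℓ} (P? : Decidable P) {a : Fin m} where

  ∈-subset⁺ : P a → a ∈ subset P?
  ∈-subset⁺ pa = lookup⇒[]= a _ (trans (lookup∘tabulate _ a) (dec-true (P? a) pa))

  ∈-subset⁻ : a ∈ subset P? → P a
  ∈-subset⁻ a∈ with P? a | trans (sym (lookup∘tabulate (does ∘ P?) a)) ([]=⇒lookup a∈)
  ... | yes pa | _  = pa
  ... | no _   | ()

module _ {m} (Adj : Fin m → Fin m → Bool) where

  -- Terminates because P shrinks: after its last visit to u, a walk from u to
  -- v ≠ u stays inside P ∖ u.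
  reachIn?-acc : ∀ {P} (P? : Decidable P) → Acc _<_ ∣ subset P? ∣ → ∀ u v → Dec (ReachIn Adj P u v)
  reachIn?-acc {P} P? (acc smaller) u v with P? u | u ≟ v
  ... | no ¬pu | _        = no (¬pu ∘ source-P)
  ... | yes pu | yes refl = yes (here pu)
  ... | yes pu | no u≢v   =
    Dec-map′ (λ (w , e , r) → step pu e (weaken proj₁ r)) (lastDeparture u≢v)
      (any? λ w → (Adj u w ≟ᵇ true) ×-dec reachIn?-acc (P? ∖? u) (smaller shrinks) w v)
    where
    shrinks : ∣ subset (P? ∖? u) ∣ < ∣ subset P? ∣
    shrinks = p⊂q⇒∣p∣<∣q∣
      ( (λ w∈ → ∈-subset⁺ P? (proj₁ (∈-subset⁻ (P? ∖? u) w∈)))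
      , u , ∈-subset⁺ P? pu , (λ u∈ → proj₂ (∈-subset⁻ (P? ∖? u) u∈) refl) )

  reachIn? : ∀ {P} → Decidable P → ∀ u v → Dec (ReachIn Adj P u v)
  reachIn? P? = reachIn?-acc P? (<-wellFounded _)

  reach? : ∀ u v → Dec (Reach Adj u v)
  reach? = reachIn? (λ _ → yes tt)

Unique⇒lookup-injective : ∀ {A : Set} {xs : List A} → Unique xs →
  ∀ i j → List.lookup xs i ≡ List.lookup xs j → i ≡ j
Unique⇒lookup-injective (_ ∷ _) zero zero _ = refl
Unique⇒lookup-injective (x∉ ∷ _) zero (suc j) eq = ⊥-elim (All.lookup x∉ (∈-lookup j) eq)
Unique⇒lookup-injective (x∉ ∷ _) (suc i) zero eq = ⊥-elim (All.lookup x∉ (∈-lookup i) (sym eq))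
Unique⇒lookup-injective (_ ∷ u) (suc i) (suc j) eq = cong suc (Unique⇒lookup-injective u i j eq)

module _ {m} (Adj : Fin m → Fin m → Bool) (undirected : Undirected Adj) where

  private
    -- Each component is represented by its least vertex.
    IsLeast : Pred (Fin m) 0ℓ
    IsLeast a = ¬ ∃ λ b → b <ᶠ a × Reach Adj b a

    smaller? : ∀ a → Dec (∃ λ b → b <ᶠ a × Reach Adj b a)
    smaller? a = any? λ b → (b <? a) ×-dec reach? Adj b a

    representatives : List (Fin m)
    representatives = filter (¬? ∘ smaller?) (allFin m)

    rep : Fin (length representatives) → Fin m
    rep = List.lookup representatives

    rep-isLeast : ∀ i → IsLeast (rep i)
    rep-isLeast i = proj₂ (∈-filter⁻ (¬? ∘ smaller?) {xs = allFin m} (∈-lookup i))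

    rep-distinct : ∀ i j → Reach Adj (rep i) (rep j) → i ≡ j
    rep-distinct i j r =
      Unique⇒lookup-injective (filter⁺ (¬? ∘ smaller?) (allFin⁺ m)) i j rep-i≡rep-j
      where
      rep-i≡rep-j : rep i ≡ rep j
      rep-i≡rep-j with <-cmp (rep i) (rep j)
      ... | tri< i<j _ _ = ⊥-elim (rep-isLeast j (rep i , i<j , r))
      ... | tri≈ _ i≡j _ = i≡j
      ... | tri> _ _ j<i = ⊥-elim (rep-isLeast i (rep j , j<i , reverse undirected r))

    reachedByRep : ∀ v → Acc _<ᶠ_ v → ∃ λ i → Reach Adj (rep i) v
    reachedByRep v (acc below) with smaller? v
    ... | yes (b , b<v , b→v) = map₂ (_++ b→v) (reachedByRep b (below b<v))
    ... | no isLeast =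
      Any.index v∈ , subst (λ r → Reach Adj r v) (lookup-index v∈) (here tt)
      where v∈ = ∈-filter⁺ (¬? ∘ smaller?) (∈-allFin v) isLeast

  hasNumComponents : ∃ (HasNumComponents Adj)
  hasNumComponents =
    length representatives , rep , rep-distinct , λ v → reachedByRep v (<ᶠ-wellFounded v)

HasNumComponents-resp : ∀ {m} {A B : Fin m → Fin m → Bool} {c} →
  (∀ {a b} → Reach A a b → Reach B a b) → (∀ {a b} → Reach B a b → Reach A a b) →
  HasNumComponents A c → HasNumComponents B c
HasNumComponents-resp A⇒B B⇒A (rep , distinct , reached) =
  rep , (λ i j → distinct i j ∘ B⇒A) , (λ v → map₂ A⇒B (reached v))

module _ (G : Graph) (u : Fin (n G)) where

  reachable : Subset (n G)
  reachable = subset (reach? (E G) u)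

  ∈-reachable⁺ : ∀ {a} → Reach (E G) u a → a ∈ reachable
  ∈-reachable⁺ = ∈-subset⁺ (reach? (E G) u)

  ∈-reachable⁻ : ∀ {a} → a ∈ reachable → Reach (E G) u a
  ∈-reachable⁻ = ∈-subset⁻ (reach? (E G) u)

  reachable-isComponent : IsComponent G reachable
  reachable-isComponent =
    (u , ∈-reachable⁺ (here tt)) ,
    (λ a b a∈ b∈ → let u→a = ∈-reachable⁻ a∈ in
       within u→a (reverse (E-sym G) u→a ++ ∈-reachable⁻ b∈)) ,
    (λ a b a∈ e → ∈-reachable⁺ (snoc (∈-reachable⁻ a∈) e tt))
    where
    within : ∀ {a b} → Reach (E G) u a → Reach (E G) a b → ReachIn (E G) (_∈ reachable) a b
    within u→a (here _)     = here (∈-reachable⁺ u→a)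
    within u→a (step _ e r) = step (∈-reachable⁺ u→a) e (within (snoc u→a e tt) r)

∑-mono-≤ : ∀ {m} {f g : Fin m → ℕ} → (∀ i → f i ≤ g i) → sum f ≤ sum g
∑-mono-≤ {zero}  f≤g = z≤n
∑-mono-≤ {suc m} f≤g = +-mono-≤ (f≤g zero) (∑-mono-≤ (f≤g ∘ suc))

∑-mono-< : ∀ {m} {f g : Fin m → ℕ} → (∀ i → f i ≤ g i) → ∀ j → f j < g j → sum f < sum g
∑-mono-< {suc m} f≤g zero    fj<gj = +-mono-<-≤ fj<gj (∑-mono-≤ (f≤g ∘ suc))
∑-mono-< {suc m} f≤g (suc j) fj<gj = +-mono-≤-< (f≤g zero) (∑-mono-< (f≤g ∘ suc) j fj<gj)

edgeCount : ∀ {m} → (Fin m → Fin m → Bool) → ℕ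
edgeCount Adj = sum λ a → sum λ b → if Adj a b then 1 else 0

edgeCount-permute : ∀ {m} {A B : Fin m → Fin m → Bool} (π : Fin m ↔ Fin m) →
  (∀ a b → B (Inverse.to π a) (Inverse.to π b) ≡ A a b) → edgeCount B ≡ edgeCount A
edgeCount-permute {A = A} {B} π B∘π≡A = begin
  edgeCount B                                 ≡⟨ sum-permute (sum ∘ row) π ⟩
  sum (λ a → sum (row (π⟨$⟩ a)))              ≡⟨ sum-cong-≗ (λ a → sum-permute (row (π⟨$⟩ a)) π) ⟩
  sum (λ a → sum λ b → row (π⟨$⟩ a) (π⟨$⟩ b)) ≡⟨ sum-cong-≗ (λ a → sum-cong-≗ λ b →
                                                   cong (if_then 1 else 0) (B∘π≡A a b)) ⟩
  edgeCount A                                 ∎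
  where
  open ≡-Reasoning
  π⟨$⟩_ = Inverse.to π
  row : Fin _ → Fin _ → ℕ
  row a b = if B a b then 1 else 0

edgeCount-< : ∀ {m} {A B : Fin m → Fin m → Bool} → (∀ a b → B a b ≡ true → A a b ≡ true) →
  ∀ a b → A a b ≡ true → B a b ≡ false → edgeCount B < edgeCount A
edgeCount-< {A = A} {B} B⊆A a b Aab Bab =
  ∑-mono-< (λ a → ∑-mono-≤ (cell≤ a)) a (∑-mono-< (cell≤ a) b cell<)
  where
  cell< : (if B a b then 1 else 0) < (if A a b then 1 else 0)
  cell< rewrite Aab | Bab = ≤-refl
  cell≤ : ∀ a b → (if B a b then 1 else 0) ≤ (if A a b then 1 else 0)
  cell≤ a b with B a b in Bab
  ... | false = z≤n
  ... | true rewrite B⊆A a b Bab = ≤-refl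

spanning : (G : Graph) (keep : Fin (n G) → Fin (n G) → Bool) → Undirected keep → Graph
spanning G keep undirected = record
  { n     = n G
  ; E     = λ a b → E G a b ∧ keep a b
  ; E-sym = λ a b → cong₂ _∧_ (E-sym G a b) (undirected a b)
  ; E-irr = λ a → cong (_∧ keep a a) (E-irr G a)
  }

module _ (G : Graph) {keep : Fin (n G) → Fin (n G) → Bool} {undirected : Undirected keep} where

  private
    H = spanning G keep undirected

  spanning-⊆ : ∀ a b → E H a b ≡ true → E G a b ≡ true
  spanning-⊆ a b e with E G a b
  ... | true = refl

  spanning-isProperMinor : ∀ a b → E G a b ≡ true → E H a b ≡ false → IsProperMinor H G
  spanning-isProperMinor a b Gab Hab = minor , ¬iso
    where
    minor : IsMinor H G
    minor = record
      { β         = just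
      ; nonempty  = λ h → h , refl
      ; connected = λ { h _ _ refl refl → here refl }
      ; edges     = λ h h′ e → h , h′ , refl , refl , spanning-⊆ h h′ e
      }
    ¬iso : ¬ Iso G H
    ¬iso (π , preserves) =
      <-irrefl (edgeCount-permute π preserves) (edgeCount-< spanning-⊆ a b Gab Hab)

adjacent⇒≢ : ∀ (G : Graph) {a b} → E G a b ≡ true → a ≢ b
adjacent⇒≢ G {a} e refl with () ← trans (sym e) (E-irr G a)

joins : ∀ {m} → Fin m → Subset m → Fin m → Fin m → Bool
joins x D a b = does (a ≟ x) ∧ does (b ∈? D)

detach : (G : Graph) → Fin (n G) → Subset (n G) → Graph
detach G x D =
  spanning G (λ a b → not (joins x D a b ∨ joins x D b a))
             (λ a b → cong not (∨-comm (joins x D a b) (joins x D b a)))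

module _ (G : Graph) (x : Fin (n G)) (D : Subset (n G)) where

  detach-keeps : ∀ {a b} → E G a b ≡ true → a ≢ x → b ≢ x → E (detach G x D) a b ≡ true
  detach-keeps {a} {b} e a≢x b≢x rewrite e | dec-false (a ≟ x) a≢x | dec-false (b ≟ x) b≢x = refl

  detach-keeps-x : ∀ {b} → E G x b ≡ true → b ∉ D → E (detach G x D) x b ≡ true
  detach-keeps-x {b} e b∉D
    rewrite e | dec-true (x ≟ x) refl | dec-false (b ∈? D) b∉D
          | dec-false (b ≟ x) (adjacent⇒≢ G e ∘ sym) = refl

  detach-removes : ∀ {b} → b ∈ D → E (detach G x D) x b ≡ false
  detach-removes {b} b∈D rewrite dec-true (x ≟ x) refl | dec-true (b ∈? D) b∈D = ∧-zeroʳ (E G x b)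

  detach-isProperMinor : ∀ {b} → E G x b ≡ true → b ∈ D → IsProperMinor (detach G x D) G
  detach-isProperMinor e b∈D = spanning-isProperMinor G _ _ e (detach-removes b∈D)

piecewise : ∀ {m} → Subset m → Subset m → Subset m → Subset m
piecewise []            []      []      = []
piecewise (inside ∷ L)  (s ∷ p) (_ ∷ q) = s ∷ piecewise L p q
piecewise (outside ∷ L) (_ ∷ p) (t ∷ q) = t ∷ piecewise L p q

∈-piecewiseˡ : ∀ {m} {L p q : Subset m} {a} → a ∈ L → a ∈ p → a ∈ piecewise L p q
∈-piecewiseˡ {L = inside ∷ _}  {_ ∷ _} {_ ∷ _} here        here        = here
∈-piecewiseˡ {L = inside ∷ _}  {_ ∷ _} {_ ∷ _} (there a∈L) (there a∈p) = there (∈-piecewiseˡ a∈L a∈p)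
∈-piecewiseˡ {L = outside ∷ _} {_ ∷ _} {_ ∷ _} (there a∈L) (there a∈p) = there (∈-piecewiseˡ a∈L a∈p)

∈-piecewiseʳ : ∀ {m} {L p q : Subset m} {a} → a ∉ L → a ∈ q → a ∈ piecewise L p q
∈-piecewiseʳ {L = inside ∷ _}  {_ ∷ _} {_ ∷ _} a∉L here        = ⊥-elim (a∉L here)
∈-piecewiseʳ {L = outside ∷ _} {_ ∷ _} {_ ∷ _} a∉L here        = here
∈-piecewiseʳ {L = inside ∷ _}  {_ ∷ _} {_ ∷ _} a∉L (there a∈q) = there (∈-piecewiseʳ (a∉L ∘ there) a∈q)
∈-piecewiseʳ {L = outside ∷ _} {_ ∷ _} {_ ∷ _} a∉L (there a∈q) = there (∈-piecewiseʳ (a∉L ∘ there) a∈q)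

∣∷∣+∣∷∣-cong : ∀ {m} s t (p q p′ q′ : Subset m) → ∣ p ∣ + ∣ q ∣ ≡ ∣ p′ ∣ + ∣ q′ ∣ →
               ∣ s ∷ p ∣ + ∣ t ∷ q ∣ ≡ ∣ s ∷ p′ ∣ + ∣ t ∷ q′ ∣
∣∷∣+∣∷∣-cong outside outside p q p′ q′ eq = eq
∣∷∣+∣∷∣-cong inside  outside p q p′ q′ eq = cong suc eq
∣∷∣+∣∷∣-cong outside inside  p q p′ q′ eq =
  trans (+-suc ∣ p ∣ ∣ q ∣) (trans (cong suc eq) (sym (+-suc ∣ p′ ∣ ∣ q′ ∣)))
∣∷∣+∣∷∣-cong inside  inside  p q p′ q′ eq = cong suc (∣∷∣+∣∷∣-cong outside inside p q p′ q′ eq)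

∣piecewise∣ : ∀ {m} (L p q : Subset m) → ∣ piecewise L p q ∣ + ∣ piecewise L q p ∣ ≡ ∣ p ∣ + ∣ q ∣
∣piecewise∣ []            []      []      = refl
∣piecewise∣ (inside ∷ L)  (s ∷ p) (t ∷ q) =
  ∣∷∣+∣∷∣-cong s t (piecewise L p q) (piecewise L q p) p q (∣piecewise∣ L p q)
∣piecewise∣ (outside ∷ L) (s ∷ p) (t ∷ q) =
  trans (+-comm ∣ t ∷ piecewise L p q ∣ ∣ s ∷ piecewise L q p ∣)
        (∣∷∣+∣∷∣-cong s t (piecewise L q p) (piecewise L p q) p q
           (trans (+-comm ∣ piecewise L q p ∣ ∣ piecewise L p q ∣) (∣piecewise∣ L p q)))

∣p∪q∣≤∣p∣+∣q∣ : ∀ {m} (p q : Subset m) → ∣ p ∪ q ∣ ≤ ∣ p ∣ + ∣ q ∣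
∣p∪q∣≤∣p∣+∣q∣ []            []            = z≤n
∣p∪q∣≤∣p∣+∣q∣ (inside ∷ p)  (t ∷ q)       =
  s≤s (≤-trans (∣p∪q∣≤∣p∣+∣q∣ p q) (+-monoʳ-≤ ∣ p ∣ (∣p∣≤∣x∷p∣ t q)))
∣p∪q∣≤∣p∣+∣q∣ (outside ∷ p) (inside ∷ q)  =
  subst (suc ∣ p ∪ q ∣ ≤_) (sym (+-suc ∣ p ∣ ∣ q ∣)) (s≤s (∣p∪q∣≤∣p∣+∣q∣ p q))
∣p∪q∣≤∣p∣+∣q∣ (outside ∷ p) (outside ∷ q) = ∣p∪q∣≤∣p∣+∣q∣ p q

m+n≤1+k+k⇒m≤k⊎n≤k : ∀ {k m n} → m + n ≤ suc (k + k) → m ≤ k ⊎ n ≤ k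
m+n≤1+k+k⇒m≤k⊎n≤k {k} {m} {n} m+n≤ with m ≤? k
... | yes m≤k = inj₁ m≤k
... | no  m≰k = inj₂ (+-cancelˡ-≤ (suc k) n k (≤-trans (+-monoˡ-≤ n (≰⇒> m≰k)) m+n≤))

Covers : ∀ {m} → (Fin m → Fin m → Bool) → Subset m → Set
Covers Adj S = ∀ a b → Adj a b ≡ true → a ∈ S ⊎ b ∈ S

module _ (G : Graph) (x : Fin (n G)) {T : Subset (n G)} where

  covers-around : (∀ b → E G x b ≡ true → x ∈ T ⊎ b ∈ T) →
                  (∀ a b → E G a b ≡ true → a ≢ x → b ≢ x → a ∈ T ⊎ b ∈ T) →
                  Covers (E G) T
  covers-around at-x off-x a b e with a ≟ x | b ≟ x
  ... | yes refl | _        = at-x b e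
  ... | no _     | yes refl = swap (at-x a (trans (E-sym G x a) e))
  ... | no a≢x   | no b≢x   = off-x a b e a≢x b≢x

  detach-covers : ∀ {D} → Covers (E (detach G x D)) T → x ∈ T → Covers (E G) T
  detach-covers cover x∈T =
    covers-around (λ _ _ → inj₁ x∈T) (λ a b e a≢x b≢x → cover a b (detach-keeps G x _ e a≢x b≢x))

record Separation (G : Graph) (x : Fin (n G)) (L : Subset (n G)) : Set where
  field
    closed : ∀ {a b} → E G a b ≡ true → a ≢ x → b ≢ x → a ∈ L → b ∈ L
    inner  : ∃ λ b → E G x b ≡ true × b ∈ L
    outer  : ∃ λ b → E G x b ≡ true × b ∉ L

module _ (G : Graph) (x : Fin (n G)) (L : Subset (n G))
         (closed : ∀ {a b} → E G a b ≡ true → a ≢ x → b ≢ x → a ∈ L → b ∈ L) where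

  private
    piecewise-covers-off-x : ∀ {D D′ P Q} →
      Covers (E (detach G x D)) P → Covers (E (detach G x D′)) Q →
      ∀ a b → E G a b ≡ true → a ≢ x → b ≢ x → a ∈ piecewise L P Q ⊎ b ∈ piecewise L P Q
    piecewise-covers-off-x coverP coverQ a b e a≢x b≢x with a ∈? L
    ... | yes a∈L = ⊎-map (∈-piecewiseˡ a∈L) (∈-piecewiseˡ (closed e a≢x b≢x a∈L))
                          (coverP a b (detach-keeps G x _ e a≢x b≢x))
    ... | no a∉L  = ⊎-map (∈-piecewiseʳ a∉L)
                          (∈-piecewiseʳ (a∉L ∘ closed (trans (E-sym G b a) e) b≢x a≢x))
                          (coverQ a b (detach-keeps G x _ e a≢x b≢x))

  vertexCover-glue : ∀ {k} → HasVCAtMost k (detach G x (∁ L)) → HasVCAtMost k (detach G x L) →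
                     HasVCAtMost k G
  vertexCover-glue {k} (S₁ , ∣S₁∣≤k , cover₁) (S₂ , ∣S₂∣≤k , cover₂) with x ∈? S₁ | x ∈? S₂
  ... | yes x∈S₁ | _        = S₁ , ∣S₁∣≤k , detach-covers G x cover₁ x∈S₁
  ... | no _     | yes x∈S₂ = S₂ , ∣S₂∣≤k , detach-covers G x cover₂ x∈S₂
  ... | no x∉S₁  | no x∉S₂  =
    [ (λ ∣T₁∣≤k → T₁ , ∣T₁∣≤k , T₁-covers) , (λ ∣T₂∣≤k → T₂ , ∣T₂∣≤k , T₂-covers) ]′
      (m+n≤1+k+k⇒m≤k⊎n≤k size)
    where
    T₁ T₂ : Subset (n G)
    T₁ = piecewise L S₁ S₂
    T₂ = ⁅ x ⁆ ∪ piecewise L S₂ S₁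

    T₁-covers : Covers (E G) T₁
    T₁-covers =
      covers-around G x (λ b e → inj₂ (neighbour∈T₁ e)) (piecewise-covers-off-x cover₁ cover₂)
      where
      neighbour∈T₁ : ∀ {b} → E G x b ≡ true → b ∈ T₁
      neighbour∈T₁ {b} e with b ∈? L
      ... | yes b∈L = ∈-piecewiseˡ b∈L
        (fromInj₂ (⊥-elim ∘ x∉S₁) (cover₁ x b (detach-keeps-x G x _ e (x∈p⇒x∉∁p b∈L))))
      ... | no b∉L  = ∈-piecewiseʳ b∉L
        (fromInj₂ (⊥-elim ∘ x∉S₂) (cover₂ x b (detach-keeps-x G x _ e b∉L)))

    T₂-covers : Covers (E G) T₂
    T₂-covers = covers-around G x (λ _ _ → inj₁ (x∈p∪q⁺ (inj₁ (x∈⁅x⁆ x))))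
      (λ a b e a≢x b≢x → ⊎-map (x∈p∪q⁺ ∘ inj₂) (x∈p∪q⁺ ∘ inj₂)
                                (piecewise-covers-off-x cover₂ cover₁ a b e a≢x b≢x))

    size : ∣ T₁ ∣ + ∣ T₂ ∣ ≤ suc (k + k)
    size = begin
      ∣ T₁ ∣ + ∣ T₂ ∣                              ≤⟨ +-monoʳ-≤ ∣ T₁ ∣ (∣p∪q∣≤∣p∣+∣q∣ ⁅ x ⁆ _) ⟩
      ∣ T₁ ∣ + (∣ ⁅ x ⁆ ∣ + ∣ piecewise L S₂ S₁ ∣) ≡⟨ cong (λ s → ∣ T₁ ∣ + (s + _)) (∣⁅x⁆∣≡1 x) ⟩
      ∣ T₁ ∣ + suc ∣ piecewise L S₂ S₁ ∣           ≡⟨ +-suc ∣ T₁ ∣ _ ⟩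
      suc (∣ T₁ ∣ + ∣ piecewise L S₂ S₁ ∣)         ≡⟨ cong suc (∣piecewise∣ L S₁ S₂) ⟩
      suc (∣ S₁ ∣ + ∣ S₂ ∣)                        ≤⟨ s≤s (+-mono-≤ ∣S₁∣≤k ∣S₂∣≤k) ⟩
      suc (k + k)                                  ∎
      where open ≤-Reasoning

obstruction-¬separation : ∀ {k G x L} → IsObstruction k G → ¬ Separation G x L
obstruction-¬separation {G = G} {x} {L} (∉𝒱ₖ , minors∈𝒱ₖ)
  record { closed = closed ; inner = _ , e₁ , b₁∈L ; outer = _ , e₂ , b₂∉L } =
  ∉𝒱ₖ (vertexCover-glue G x L closed
        (minors∈𝒱ₖ _ (detach-isProperMinor G x (∁ L) e₂ (x∉p⇒x∈∁p b₂∉L)))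
        (minors∈𝒱ₖ _ (detach-isProperMinor G x L e₁ b₁∈L)))

module _ {G : Graph} {C : Subset (n G)} (component : IsComponent G C) {x u v : Fin (n G)} where

  private
    connected = proj₁ (proj₂ component)
    closed    = proj₂ (proj₂ component)

  cut⇒separation : u ∈ C → u ≢ x → v ∈ C → v ≢ x → ¬ ReachIn (E G) ((_∈ C) ∖ x) u v →
                   ∃ (Separation G x)
  cut⇒separation u∈C u≢x v∈C v≢x ¬u→v = subset from-u? , record
    { closed = λ e a≢x b≢x a∈L → let u→a = ∈-subset⁻ from-u? a∈L in
        ∈-subset⁺ from-u? (snoc u→a e (closed _ _ (proj₁ (target-P u→a)) e , b≢x))
    ; inner  = let (b , e , b→u) = lastDeparture (u≢x ∘ sym) (connected x u x∈C u∈C) in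
        b , e , ∈-subset⁺ from-u? (reverse (E-sym G) b→u)
    ; outer  = let (b , e , b→v) = lastDeparture (v≢x ∘ sym) (connected x v x∈C v∈C) in
        b , e , λ b∈L → ¬u→v (∈-subset⁻ from-u? b∈L ++ b→v)
    }
    where
    from-u? = reachIn? (E G) ((_∈? C) ∖? x) u

    x∈C : x ∈ C
    x∈C = decidable-stable (x ∈? C) λ x∉C →
      ¬u→v (weaken (λ w∈C → w∈C , λ { refl → x∉C w∈C }) (connected u v u∈C v∈C))

obstruction⇒components-twoConnected : ∀ {k G} → IsObstruction k G →
  ∀ C → IsComponent G C → TwoConnectedIn G C
obstruction⇒components-twoConnected {G = G} obstruction C component =
  proj₁ (proj₂ component) , λ x u v (u∈C , u≢x) (v∈C , v≢x) →
    decidable-stable (reachIn? (E G) ((_∈? C) ∖? x) u v) λ ¬u→v →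
      obstruction-¬separation obstruction (proj₂ (cut⇒separation component u∈C u≢x v∈C v≢x ¬u→v))

isYes-∧-false : ∀ {A B : Set} (a? : Dec A) (b? : Dec B) → ¬ (A × B) → ⌊ a? ⌋ ∧ ⌊ b? ⌋ ≡ false
isYes-∧-false (yes a) (yes b) ¬ab = ⊥-elim (¬ab (a , b))
isYes-∧-false (yes _) (no _)  _   = refl
isYes-∧-false (no _)  _       _   = refl

module _ (G : Graph) (u v : Fin (n G)) where

  private
    D = deleteEdge G u v

  deleteEdge-undirected : Undirected D
  deleteEdge-undirected a b = cong₂ _∧_ (E-sym G a b) (cong not (begin
    (⌊ a ≟ u ⌋ ∧ ⌊ b ≟ v ⌋) ∨ (⌊ a ≟ v ⌋ ∧ ⌊ b ≟ u ⌋) ≡⟨ ∨-comm (⌊ a ≟ u ⌋ ∧ ⌊ b ≟ v ⌋) _ ⟩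
    (⌊ a ≟ v ⌋ ∧ ⌊ b ≟ u ⌋) ∨ (⌊ a ≟ u ⌋ ∧ ⌊ b ≟ v ⌋)
      ≡⟨ cong₂ _∨_ (∧-comm ⌊ a ≟ v ⌋ _) (∧-comm ⌊ a ≟ u ⌋ _) ⟩
    (⌊ b ≟ u ⌋ ∧ ⌊ a ≟ v ⌋) ∨ (⌊ b ≟ v ⌋ ∧ ⌊ a ≟ u ⌋) ∎))
    where open ≡-Reasoning

  deleteEdge-⊆ : ∀ a b → D a b ≡ true → E G a b ≡ true
  deleteEdge-⊆ a b e with E G a b
  ... | true = refl

  deleteEdge-keeps : ∀ {a b} → E G a b ≡ true → ¬ (a ≡ u × b ≡ v) → ¬ (a ≡ v × b ≡ u) → D a b ≡ true
  deleteEdge-keeps {a} {b} e ¬uv ¬vu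
    rewrite e | isYes-∧-false (a ≟ u) (b ≟ v) ¬uv | isYes-∧-false (a ≟ v) (b ≟ u) ¬vu = refl

  avoiding-u⇒reach : ∀ {P a b} → ReachIn (E G) (P ∖ u) a b → Reach D a b
  avoiding-u⇒reach =
    ReachIn-map _ λ (_ , a≢u) (_ , b≢u) e → deleteEdge-keeps e (a≢u ∘ proj₁) (b≢u ∘ proj₂)

  avoiding-v⇒reach : ∀ {P a b} → ReachIn (E G) (P ∖ v) a b → Reach D a b
  avoiding-v⇒reach =
    ReachIn-map _ λ (_ , a≢v) (_ , b≢v) e → deleteEdge-keeps e (b≢v ∘ proj₂) (a≢v ∘ proj₁)

  reach-deleteEdge : Reach D u v → ∀ {a b} → Reach (E G) a b → Reach D a b
  reach-deleteEdge u→v (here _)                      = here tt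
  reach-deleteEdge u→v (step {u = a} {w = b} _ e r) = edge ++ reach-deleteEdge u→v r
    where
    edge : Reach D a b
    edge with (a ≟ u) ×-dec (b ≟ v) | (a ≟ v) ×-dec (b ≟ u)
    ... | yes (refl , refl) | _                 = u→v
    ... | no _              | yes (refl , refl) = reverse deleteEdge-undirected u→v
    ... | no ¬uv            | no ¬vu            = step tt (deleteEdge-keeps e ¬uv ¬vu) (here tt)

  bridge-separates : IsBridge G u v → ¬ Reach D u v
  bridge-separates (_ , fewer) u→v with hasNumComponents (E G) (E-sym G)
  ... | c , components-G = <-irrefl refl (fewer c c components-G components-D)
    where
    components-D = HasNumComponents-resp (reach-deleteEdge u→v)
                     (ReachIn-map _ λ _ _ → deleteEdge-⊆ _ _) components-G

  bridge-isolated : (∀ C → IsComponent G C → TwoConnectedIn G C) → IsBridge G u v →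
                    ∀ w → Reach (E G) u w → w ≡ u ⊎ w ≡ v
  bridge-isolated twoConnected bridge w u→w with w ≟ u | w ≟ v
  ... | yes w≡u | _       = inj₁ w≡u
  ... | no _    | yes w≡v = inj₂ w≡v
  ... | no w≢u  | no w≢v  = ⊥-elim (bridge-separates bridge u→v)
    where
    avoiding = proj₂ (twoConnected (reachable G u) (reachable-isComponent G u))
    u∈C = ∈-reachable⁺ G u (here tt)
    v∈C = ∈-reachable⁺ G u (step tt (proj₁ bridge) (here tt))
    w∈C = ∈-reachable⁺ G u u→w
    u≢v = adjacent⇒≢ G (proj₁ bridge)
    u→v : Reach D u v
    u→v = reverse deleteEdge-undirected (avoiding-v⇒reach (avoiding v w u (w∈C , w≢v) (u∈C , u≢v)))
       ++ avoiding-u⇒reach (avoiding u w v (w∈C , w≢u) (v∈C , u≢v ∘ sym))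

lemma4p3 : (k : ℕ) (G : Graph) → IsObstruction k G →
    (∀ (C : Subset (n G)) → IsComponent G C → TwoConnectedIn G C) ×
    (∀ (u v : Fin (n G)) → IsBridge G u v →
      ∀ w → Reach (E G) u w → (w ≡ u ⊎ w ≡ v))
lemma4p3 k G obstruction =
  twoConnected , λ u v → bridge-isolated G u v twoConnected
  where
  twoConnected = obstruction⇒components-twoConnected obstruction
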